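{- Let $T$ be a finitary monad on $\mathsf{Set}$, $H\colon\mathsf{Set}\to\mathsf{Set}$ a finitary functor, and $H^T\colon\mathsf{Set}^T\to\mathsf{Set}^T$ a lifting of $H$. Then the locally finite fixpoint $\vartheta H^T$, regarded as a subcoalgebra of the final $H^T$-coalgebra (whose carrier is $\nu H$), satisfies \[\vartheta H^T=\bigcup_{\substack{x\colon X\to HTX\\ X\text{ finite}}} x^{\sharp\ddagger}[TX]=\bigcup_{\substack{x\colon X\to HTX\\ X\text{ finite}}} x^{\sharp\ddagger}\cdot\eta^T_X[X]\subseteq\nu H,\] where the unions range over all $HT$-coalgebras with finite carrier.
   Context: $\mathsf{Set}^T$ is the Eilenberg–Moore category of $T$, with forgetful functor $U\colon\mathsf{Set}^T\to\mathsf{Set}$; a lifting of $H$ is a functor $H^T$ with $U\cdot H^T=H\cdot U$. For an $HT$-coalgebra $x\colon X\to HTX$, $HTX$ carries the $T$-algebra $H^T(TX,\mu_X)$, and $x^\sharp\colon TX\to HTX$ denotes the unique $T$-algebra morphism from the free algebra $(TX,\mu_X)$ to it with $x^\sharp\cdot\eta_X=x$; $x^{\sharp\ddagger}\colon TX\to\nu H$ denotes the unique $H$-coalgebra homomorphism from $(TX,x^\sharp)$ to the final $H$-coalgebra $\nu H$. The final $H^T$-coalgebra is carried by $\nu H$ with a canonical $T$-algebra structure. The locally finite fixpoint $\vartheta H^T$ is the final locally finitely generated $H^T$-coalgebra, where an $H^T$-coalgebra $(X,x)$ is lfg if every morphism $f\colon S\to X$ from a finitely generated $T$-algebra $S$ factors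 as $h\cdot f'$ through a homomorphism $h\colon(P,p)\to(X,x)$ from a coalgebra with finitely generated carrier; it is a subcoalgebra of the final $H^T$-coalgebra. -}

module Defs where

open import Level using (Level; _⊔_) renaming (suc to lsuc; zero to lzero)
open import Data.Nat using (ℕ)
open import Data.Fin using (Fin)
open import Data.Product using (Σ; _×_; _,_; ∃; ∃-syntax)
open import Function using (_∘_; id)
open import Function.Bundles using (_↔_)
open import Relation.Binary.PropositionalEquality using (_≡_)

infix 4 _≐_
_≐_ : {A B : Set} → (A → B) → (A → B) → Set
f ≐ g = ∀ a → f a ≡ g a

record Functor : Set₁ where
  field
    F₀     : Set → Set
    fmap   : {A B : Set} → (A → B) → F₀ A → F₀ B
    fmap-id : {A : Set} → fmap (id {A = A}) ≐ id
    fmap-∘  : {A B C : Set} (g : B → C) (f : A → B) →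
              fmap (g ∘ f) ≐ fmap g ∘ fmap f
    fmap-cong : {A B : Set} {f g : A → B} → f ≐ g → fmap f ≐ fmap g

-- Finitary Set-functor: every element of F X lies in the image of F m
-- for some map m from a finite set (standard characterisation of
-- preservation of filtered colimits for endofunctors of Set).
Finitary : Functor → Set₁
Finitary F = ∀ (X : Set) (y : F₀ X) →
  Σ ℕ λ n → Σ (Fin n → X) λ m → Σ (F₀ (Fin n)) λ y' → fmap m y' ≡ y
  where open Functor F

record Monad : Set₁ where
  field
    functor : Functor
  open Functor functor public renaming (F₀ to T₀)
  field
    η : {A : Set} → A → T₀ A
    μ : {A : Set} → T₀ (T₀ A) → T₀ A
    η-nat : {A B : Set} (f : A → B) → fmap f ∘ η ≐ η ∘ f
    μ-nat : {A B : Set} (f : A → B) → fmap f ∘ μ ≐ μ ∘ fmap (fmap f)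
    μ-η   : {A : Set} → μ ∘ η {T₀ A} ≐ id
    μ-Tη  : {A : Set} → μ ∘ fmap (η {A}) ≐ id
    μ-assoc : {A : Set} → μ {A} ∘ μ ≐ μ ∘ fmap μ

FinitaryMonad : Monad → Set₁
FinitaryMonad T = Finitary (Monad.functor T)

module _ (T : Monad) where
  open Monad T

  record IsAlgebra {A : Set} (a : T₀ A → A) : Set where
    field
      unit  : a ∘ η ≐ id
      assoc : a ∘ μ ≐ a ∘ fmap a

  record Algebra : Set₁ where
    field
      Carrier : Set
      str     : T₀ Carrier → Carrier
      isAlg   : IsAlgebra str

  IsAlgHom : (A B : Algebra) → (Algebra.Carrier A → Algebra.Carrier B) → Set
  IsAlgHom A B f = f ∘ Algebra.str A ≐ Algebra.str B ∘ fmap f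

  FreeAlg : Set → Algebra
  FreeAlg X = record { Carrier = T₀ X ; str = μ
                     ; isAlg = record { unit = μ-η ; assoc = μ-assoc } }

  -- Finitely generated T-algebra: a quotient of a free algebra on a
  -- finite set, i.e. a surjective algebra morphism T(Fin n) → A.
  FinitelyGenerated : Algebra → Set
  FinitelyGenerated A =
    Σ ℕ λ n → Σ (T₀ (Fin n) → Algebra.Carrier A) λ e →
      IsAlgHom (FreeAlg (Fin n)) A e ×
      (∀ a → Σ (T₀ (Fin n)) λ t → e t ≡ a)

-- A lifting H^T of H to Set^T (so U·H^T = H·U): an assignment of a
-- T-algebra structure on H A to every T-algebra (A, a), such that H f is
-- an algebra morphism whenever f is (functor laws are then inherited from H).
record Lifting (T : Monad) (H : Functor) : Set₁ where
  open Monad T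
  open Functor H renaming (F₀ to H₀; fmap to Hmap)
  field
    lift     : (A : Algebra T) → T₀ (H₀ (Algebra.Carrier A)) → H₀ (Algebra.Carrier A)
    lift-alg : (A : Algebra T) → IsAlgebra T (lift A)
  liftAlg : Algebra T → Algebra T
  liftAlg A = record { Carrier = H₀ (Algebra.Carrier A) ; str = lift A ; isAlg = lift-alg A }
  field
    lift-hom : (A B : Algebra T) (f : Algebra.Carrier A → Algebra.Carrier B) →
               IsAlgHom T A B f → IsAlgHom T (liftAlg A) (liftAlg B) (Hmap f)

record FinalCoalgebra (H : Functor) : Set₁ where
  open Functor H renaming (F₀ to H₀; fmap to Hmap)
  field
    νH     : Set
    out    : νH → H₀ νH
    unfold : {C : Set} → (C → H₀ C) → C → νH
    unfold-hom : {C : Set} (c : C → H₀ C) → out ∘ unfold c ≐ Hmap (unfold c) ∘ c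
    unfold-unique : {C : Set} (c : C → H₀ C) (g : C → νH) →
                    out ∘ g ≐ Hmap g ∘ c → g ≐ unfold c

module _ (T : Monad) (H : Functor) (HT : Lifting T H) where
  open Monad T
  open Functor H renaming (F₀ to H₀; fmap to Hmap)
  open Lifting HT

  record LCoalg : Set₁ where
    field
      alg    : Algebra T
      coalg  : Algebra.Carrier alg → H₀ (Algebra.Carrier alg)
      coalg-hom : IsAlgHom T alg (liftAlg alg) coalg
    Carrier : Set
    Carrier = Algebra.Carrier alg

  IsLCoalgHom : (P X : LCoalg) → (LCoalg.Carrier P → LCoalg.Carrier X) → Set
  IsLCoalgHom P X h =
    IsAlgHom T (LCoalg.alg P) (LCoalg.alg X) h ×
    (LCoalg.coalg X ∘ h ≐ Hmap h ∘ LCoalg.coalg P)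

  LFG : LCoalg → Set₁
  LFG X = ∀ (S : Algebra T) → FinitelyGenerated T S →
    (f : Algebra.Carrier S → LCoalg.Carrier X) → IsAlgHom T S (LCoalg.alg X) f →
    Σ LCoalg λ P → FinitelyGenerated T (LCoalg.alg P) ×
      Σ (LCoalg.Carrier P → LCoalg.Carrier X) λ h → IsLCoalgHom P X h ×
      Σ (Algebra.Carrier S → LCoalg.Carrier P) λ f' →
        IsAlgHom T S (LCoalg.alg P) f' × (h ∘ f' ≐ f)

  record IsLocallyFiniteFixpoint (L : LCoalg) : Set₁ where
    field
      lfg    : LFG L
      into   : (X : LCoalg) → LFG X → LCoalg.Carrier X → LCoalg.Carrier L
      into-hom : (X : LCoalg) (p : LFG X) → IsLCoalgHom X L (into X p)
      into-unique : (X : LCoalg) (p : LFG X) (g : LCoalg.Carrier X → LCoalg.Carrier L) →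
                    IsLCoalgHom X L g → g ≐ into X p

  -- For an HT-coalgebra x : X → H T X:  x♯ : TX → HTX, the algebra morphism
  -- (TX, μ) → H^T(TX, μ) extending x, i.e. x♯ = β · T x with β the
  -- lifted structure on H T X.
  sharp : {X : Set} → (X → H₀ (T₀ X)) → T₀ X → H₀ (T₀ X)
  sharp {X} x = lift (FreeAlg T X) ∘ fmap x

  module _ (N : FinalCoalgebra H) where
    open FinalCoalgebra N

    sharpDagger : {X : Set} → (X → H₀ (T₀ X)) → T₀ X → νH
    sharpDagger x = unfold (sharp x)

    -- ϑH^T as a subset of νH: the image of the unique morphism L → νH
    -- (the underlying map of the unique H^T-coalgebra morphism into the
    -- final H^T-coalgebra, which is carried by νH).
    InTheta : (L : LCoalg) → νH → Set
    InTheta L z = Σ (LCoalg.Carrier L) λ l → unfold (LCoalg.coalg L) l ≡ z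

    InUnion₁ : νH → Set₁
    InUnion₁ z = Σ Set λ X → Σ ℕ λ n → (Fin n ↔ X) ×
      Σ (X → H₀ (T₀ X)) λ x → Σ (T₀ X) λ t → sharpDagger x t ≡ z

    InUnion₂ : νH → Set₁
    InUnion₂ z = Σ Set λ X → Σ ℕ λ n → (Fin n ↔ X) ×
      Σ (X → H₀ (T₀ X)) λ x → Σ X λ y → sharpDagger x (η y) ≡ z

-- A point of ϑH^T lies, by local finite generation, in the image of a
-- coalgebra P whose carrier is a quotient e : T(Fin n) ↠ P of a free
-- algebra.  Choosing a section s of e, the HT-coalgebra x = H s · c · e · η
-- on Fin n (c the structure of P) makes e a coalgebra morphism
-- (T(Fin n), x♯) → P, so the point is in the image of x♯‡.  Conversely, (TX, x♯) is itself lfg for finite X,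
-- so its unfolding factors through ϑH^T.  Finally, a point x♯‡(t) with
-- t ∈ TX is of the form y♯‡(η ⋆) for the coalgebra y on 1 + X that sends
-- the new generator ⋆ to x♯(t).
module Submission where

open import Defs
import Level
open import Level using (Lift)
open import Data.Nat using (ℕ; _+_)
open import Data.Fin using (Fin; zero)
open import Data.Fin.Properties using (+↔⊎)
open import Data.Product using (_×_; _,_; Σ; proj₁; proj₂)
open import Data.Sum using (_⊎_; inj₁; inj₂)
open import Data.Sum.Function.Propositional using (_⊎-↔_)
open import Function using (_∘_; id; const)
open import Function.Bundles using (_⇔_; mk⇔; _↔_; Inverse)
open import Function.Properties.Inverse using (↔-refl; ↔-trans)
open import Relation.Binary.PropositionalEquality using (_≡_; refl; sym; trans; cong; module ≡-Reasoning)

module FreeAlgebras (T : Monad) where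
  open Monad T
  open Algebra using (Carrier; str; isAlg)
  open ≡-Reasoning

  extend : {X : Set} (B : Algebra T) → (X → Carrier B) → T₀ X → Carrier B
  extend B k = str B ∘ fmap k

  extend-η : {X : Set} (B : Algebra T) (k : X → Carrier B) → extend B k ∘ η ≐ k
  extend-η B k a = begin
    str B (fmap k (η a)) ≡⟨ cong (str B) (η-nat k a) ⟩
    str B (η (k a))      ≡⟨ IsAlgebra.unit (isAlg B) (k a) ⟩
    k a                  ∎

  extend-isAlgHom : {X : Set} (B : Algebra T) (k : X → Carrier B) →
                    IsAlgHom T (FreeAlg T X) B (extend B k)
  extend-isAlgHom B k t = begin
    str B (fmap k (μ t))                   ≡⟨ cong (str B) (μ-nat k t) ⟩
    str B (μ (fmap (fmap k) t))            ≡⟨ IsAlgebra.assoc (isAlg B) (fmap (fmap k) t) ⟩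
    str B (fmap (str B) (fmap (fmap k) t)) ≡⟨ cong (str B) (fmap-∘ (str B) (fmap k) t) ⟨
    str B (fmap (extend B k) t)            ∎

  isAlgHom-id : (A : Algebra T) → IsAlgHom T A A id
  isAlgHom-id A t = cong (str A) (sym (fmap-id t))

  isAlgHom-∘ : (A B C : Algebra T) {f : Carrier A → Carrier B} {g : Carrier B → Carrier C} →
               IsAlgHom T A B f → IsAlgHom T B C g → IsAlgHom T A C (g ∘ f)
  isAlgHom-∘ A B C {f} {g} f-hom g-hom t = begin
    g (f (str A t))           ≡⟨ cong g (f-hom t) ⟩
    g (str B (fmap f t))      ≡⟨ g-hom (fmap f t) ⟩
    str C (fmap g (fmap f t)) ≡⟨ cong (str C) (fmap-∘ g f t) ⟨
    str C (fmap (g ∘ f) t)    ∎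

  free-hom-unique : {X : Set} (B : Algebra T) {g₁ g₂ : T₀ X → Carrier B} →
                    IsAlgHom T (FreeAlg T X) B g₁ → IsAlgHom T (FreeAlg T X) B g₂ →
                    g₁ ∘ η ≐ g₂ ∘ η → g₁ ≐ g₂
  free-hom-unique B {g₁} {g₂} g₁-hom g₂-hom g₁η≐g₂η t = begin
    g₁ t                         ≡⟨ cong g₁ (μ-Tη t) ⟨
    g₁ (μ (fmap η t))            ≡⟨ g₁-hom (fmap η t) ⟩
    str B (fmap g₁ (fmap η t))   ≡⟨ cong (str B) (fmap-∘ g₁ η t) ⟨
    str B (fmap (g₁ ∘ η) t)      ≡⟨ cong (str B) (fmap-cong g₁η≐g₂η t) ⟩
    str B (fmap (g₂ ∘ η) t)      ≡⟨ cong (str B) (fmap-∘ g₂ η t) ⟩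
    str B (fmap g₂ (fmap η t))   ≡⟨ g₂-hom (fmap η t) ⟨
    g₂ (μ (fmap η t))            ≡⟨ cong g₂ (μ-Tη t) ⟩
    g₂ t                         ∎

  free-finitelyGenerated : {X : Set} {n : ℕ} → Fin n ↔ X → FinitelyGenerated T (FreeAlg T X)
  free-finitelyGenerated {n = n} Fin↔X =
    n , fmap to , μ-nat to , λ t → fmap from t , fmap-to-from t
    where
    open Inverse Fin↔X
    fmap-to-from : ∀ t → fmap to (fmap from t) ≡ t
    fmap-to-from t = begin
      fmap to (fmap from t) ≡⟨ fmap-∘ to from t ⟨
      fmap (to ∘ from) t    ≡⟨ fmap-cong strictlyInverseˡ t ⟩
      fmap id t             ≡⟨ fmap-id t ⟩
      t                     ∎

module FinalCoalgebraProperties {H : Functor} (N : FinalCoalgebra H) where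
  open Functor H renaming (F₀ to H₀; fmap to Hmap; fmap-id to Hmap-id; fmap-∘ to Hmap-∘)
  open FinalCoalgebra N
  open ≡-Reasoning

  unfold-∘-hom : {C D : Set} (c : C → H₀ C) (d : D → H₀ D) {h : C → D} →
                 d ∘ h ≐ Hmap h ∘ c → unfold d ∘ h ≐ unfold c
  unfold-∘-hom c d {h} h-hom = unfold-unique c (unfold d ∘ h) λ a → begin
    out (unfold d (h a))           ≡⟨ unfold-hom d (h a) ⟩
    Hmap (unfold d) (d (h a))      ≡⟨ cong (Hmap (unfold d)) (h-hom a) ⟩
    Hmap (unfold d) (Hmap h (c a)) ≡⟨ Hmap-∘ (unfold d) h (c a) ⟨
    Hmap (unfold d ∘ h) (c a)      ∎

  -- Lambek: unfold (H out) is a left inverse of out.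
  out-injective : ∀ {a b} → out a ≡ out b → a ≡ b
  out-injective {a} {b} out-a≡out-b = begin
    a                         ≡⟨ unfold-Hout-out a ⟨
    unfold (Hmap out) (out a) ≡⟨ cong (unfold (Hmap out)) out-a≡out-b ⟩
    unfold (Hmap out) (out b) ≡⟨ unfold-Hout-out b ⟩
    b                         ∎
    where
    unfold-Hout-out : unfold (Hmap out) ∘ out ≐ id
    unfold-Hout-out a = trans (unfold-∘-hom out (Hmap out) (λ _ → refl) a)
                              (sym (unfold-unique out id (λ a → sym (Hmap-id (out a))) a))

module LocallyFiniteFixpoint (T : Monad) (H : Functor) (HT : Lifting T H) where
  open Monad T
  open Functor H renaming (F₀ to H₀; fmap to Hmap; fmap-id to Hmap-id; fmap-∘ to Hmap-∘; fmap-cong to Hmap-cong)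
  open Lifting HT
  open FreeAlgebras T
  open LCoalg using (alg; coalg; coalg-hom)
  open ≡-Reasoning

  freeLCoalg : {X : Set} → (X → H₀ (T₀ X)) → LCoalg T H HT
  freeLCoalg {X} x = record
    { alg = FreeAlg T X
    ; coalg = sharp T H HT x
    ; coalg-hom = extend-isAlgHom (liftAlg (FreeAlg T X)) x
    }

  sharp-η : {X : Set} (x : X → H₀ (T₀ X)) → sharp T H HT x ∘ η ≐ x
  sharp-η {X} = extend-η (liftAlg (FreeAlg T X))

  sharp-homomorphism : {X : Set} (x : X → H₀ (T₀ X)) (P : LCoalg T H HT)
                       {e : T₀ X → LCoalg.Carrier P} → IsAlgHom T (FreeAlg T X) (alg P) e →
                       Hmap e ∘ x ≐ coalg P ∘ e ∘ η → IsLCoalgHom T H HT (freeLCoalg x) P e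
  sharp-homomorphism {X} x P {e} e-hom e-on-generators =
    e-hom , free-hom-unique (liftAlg (alg P))
              (isAlgHom-∘ (FreeAlg T X) (alg P) (liftAlg (alg P)) e-hom (coalg-hom P))
              (isAlgHom-∘ (FreeAlg T X) (liftAlg (FreeAlg T X)) (liftAlg (alg P))
                 (coalg-hom (freeLCoalg x)) (lift-hom (FreeAlg T X) (alg P) e e-hom))
              λ a → begin
                coalg P (e (η a))             ≡⟨ e-on-generators a ⟨
                Hmap e (x a)                  ≡⟨ cong (Hmap e) (sharp-η x a) ⟨
                Hmap e (sharp T H HT x (η a)) ∎

  freeLCoalg-lfg : {X : Set} {n : ℕ} → Fin n ↔ X → (x : X → H₀ (T₀ X)) → LFG T H HT (freeLCoalg x)
  freeLCoalg-lfg {X} Fin↔X x S _ f f-hom =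
    freeLCoalg x , free-finitelyGenerated Fin↔X ,
    id , (isAlgHom-id (FreeAlg T X) , λ _ → sym (Hmap-id _)) ,
    f , f-hom , λ _ → refl

  lfg-point : (C : LCoalg T H HT) → LFG T H HT C → (c : LCoalg.Carrier C) →
              Σ (LCoalg T H HT) λ P → FinitelyGenerated T (alg P) ×
                Σ (LCoalg.Carrier P → LCoalg.Carrier C) λ h → IsLCoalgHom T H HT P C h ×
                  Σ (LCoalg.Carrier P) λ p → h p ≡ c
  lfg-point C C-lfg c
    with C-lfg (FreeAlg T (Fin 1)) (free-finitelyGenerated ↔-refl)
               (extend (alg C) (const c)) (extend-isAlgHom (alg C) (const c))
  ... | P , P-fg , h , h-hom , f' , _ , h∘f'≐f =
    P , P-fg , h , h-hom , f' (η zero) , trans (h∘f'≐f (η zero)) (extend-η (alg C) (const c) zero)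

  module _ (N : FinalCoalgebra H) where
    open FinalCoalgebra N
    open FinalCoalgebraProperties N

    unfold-LCoalgHom : (P C : LCoalg T H HT) {h : LCoalg.Carrier P → LCoalg.Carrier C} →
                       IsLCoalgHom T H HT P C h → unfold (coalg C) ∘ h ≐ unfold (coalg P)
    unfold-LCoalgHom P C (_ , h-coalgHom) = unfold-∘-hom (coalg P) (coalg C) h-coalgHom

    finitelyGenerated-unfold∈union₁ : (P : LCoalg T H HT) → FinitelyGenerated T (alg P) →
                                      ∀ p → InUnion₁ T H HT N (unfold (coalg P) p)
    finitelyGenerated-unfold∈union₁ P (n , e , e-hom , e-surjective) p =
      Fin n , n , ↔-refl , x , s p ,
      trans (sym (unfold-LCoalgHom (freeLCoalg x) P (sharp-homomorphism x P e-hom e-on-generators) (s p)))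
            (cong (unfold (coalg P)) (e∘s≐id p))
      where
      s : LCoalg.Carrier P → T₀ (Fin n)
      s q = proj₁ (e-surjective q)
      e∘s≐id : e ∘ s ≐ id
      e∘s≐id q = proj₂ (e-surjective q)
      x : Fin n → H₀ (T₀ (Fin n))
      x = Hmap s ∘ coalg P ∘ e ∘ η
      e-on-generators : Hmap e ∘ x ≐ coalg P ∘ e ∘ η
      e-on-generators i = begin
        Hmap e (Hmap s (coalg P (e (η i)))) ≡⟨ Hmap-∘ e s _ ⟨
        Hmap (e ∘ s) (coalg P (e (η i)))    ≡⟨ Hmap-cong e∘s≐id _ ⟩
        Hmap id (coalg P (e (η i)))         ≡⟨ Hmap-id _ ⟩
        coalg P (e (η i))                   ∎

    module _ (L : LCoalg T H HT) (L-fixpoint : IsLocallyFiniteFixpoint T H HT L) where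
      open IsLocallyFiniteFixpoint L-fixpoint

      theta⊆union₁ : ∀ z → InTheta T H HT N L z → InUnion₁ T H HT N z
      theta⊆union₁ z (l , unfold-l≡z) with lfg-point L lfg l
      ... | P , P-fg , h , h-hom , p , h-p≡l
        with finitelyGenerated-unfold∈union₁ P P-fg p
      ... | X , n , Fin↔X , x , t , unfold-t≡unfold-p =
        X , n , Fin↔X , x , t , (begin
          unfold (sharp T H HT x) t ≡⟨ unfold-t≡unfold-p ⟩
          unfold (coalg P) p        ≡⟨ unfold-LCoalgHom P L h-hom p ⟨
          unfold (coalg L) (h p)    ≡⟨ cong (unfold (coalg L)) h-p≡l ⟩
          unfold (coalg L) l        ≡⟨ unfold-l≡z ⟩
          z                         ∎)

      union₁⊆theta : ∀ z → InUnion₁ T H HT N z → InTheta T H HT N L z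
      union₁⊆theta z (_ , _ , Fin↔X , x , t , unfold-t≡z) =
        into C C-lfg t , trans (unfold-LCoalgHom C L (into-hom C C-lfg) t) unfold-t≡z
        where
        C = freeLCoalg x
        C-lfg = freeLCoalg-lfg Fin↔X x

    union₁⊆union₂ : ∀ z → InUnion₁ T H HT N z → InUnion₂ T H HT N z
    union₁⊆union₂ z (X , n , Fin↔X , x , t , unfold-t≡z) =
      (Fin 1 ⊎ X) , 1 + n , ↔-trans +↔⊎ (↔-refl ⊎-↔ Fin↔X) , y , ⋆ ,
      trans (out-injective (begin
        out (unfold y♯ (η ⋆))                      ≡⟨ unfold-hom y♯ (η ⋆) ⟩
        Hmap (unfold y♯) (y♯ (η ⋆))                ≡⟨ cong (Hmap (unfold y♯)) (sharp-η y ⋆) ⟩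
        Hmap (unfold y♯) (Hmap (fmap inj₂) (x♯ t)) ≡⟨ Hmap-∘ (unfold y♯) (fmap inj₂) (x♯ t) ⟨
        Hmap (unfold y♯ ∘ fmap inj₂) (x♯ t)        ≡⟨ Hmap-cong (unfold-LCoalgHom (freeLCoalg x) (freeLCoalg y) inj₂-hom) (x♯ t) ⟩
        Hmap (unfold x♯) (x♯ t)                    ≡⟨ unfold-hom x♯ t ⟨
        out (unfold x♯ t)                          ∎)) unfold-t≡z
      where
      ⋆ : Fin 1 ⊎ X
      ⋆ = inj₁ zero
      x♯ : T₀ X → H₀ (T₀ X)
      x♯ = sharp T H HT x
      y : Fin 1 ⊎ X → H₀ (T₀ (Fin 1 ⊎ X))
      y (inj₁ _) = Hmap (fmap inj₂) (x♯ t)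
      y (inj₂ a) = Hmap (fmap inj₂) (x a)
      y♯ : T₀ (Fin 1 ⊎ X) → H₀ (T₀ (Fin 1 ⊎ X))
      y♯ = sharp T H HT y
      inj₂-hom : IsLCoalgHom T H HT (freeLCoalg x) (freeLCoalg y) (fmap inj₂)
      inj₂-hom = sharp-homomorphism x (freeLCoalg y) (μ-nat inj₂) λ a → begin
        Hmap (fmap inj₂) (x a)    ≡⟨⟩
        y (inj₂ a)                ≡⟨ sharp-η y (inj₂ a) ⟨
        y♯ (η (inj₂ a))           ≡⟨ cong y♯ (η-nat inj₂ a) ⟨
        y♯ (fmap inj₂ (η a))      ∎

    union₂⊆union₁ : ∀ z → InUnion₂ T H HT N z → InUnion₁ T H HT N z
    union₂⊆union₁ z (X , n , Fin↔X , x , a , unfold-ηa≡z) = X , n , Fin↔X , x , η a , unfold-ηa≡z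

open LocallyFiniteFixpoint

mainTheorem7 : (T : Monad) → FinitaryMonad T →
    (H : Functor) → Finitary H → (HT : Lifting T H) →
    (N : FinalCoalgebra H) →
    (L : LCoalg T H HT) → IsLocallyFiniteFixpoint T H HT L →
    ∀ z → (Lift (Level.suc Level.zero) (InTheta T H HT N L z) ⇔ InUnion₁ T H HT N z)
        × (InUnion₁ T H HT N z ⇔ InUnion₂ T H HT N z)
mainTheorem7 T _ H _ HT N L L-fixpoint z =
  mk⇔ (theta⊆union₁ T H HT N L L-fixpoint z ∘ Level.lower)
      (Level.lift ∘ union₁⊆theta T H HT N L L-fixpoint z) ,
  mk⇔ (union₁⊆union₂ T H HT N z) (union₂⊆union₁ T H HT N z)
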